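{- Let $T$ be the set of terms built from the single variable $x$ using two binary operation symbols $*$ and $\circ$, let $\mathcal{W}$ be the free monoid on the letters $\Sigma_\alpha^{+},\Sigma_\alpha^{ - },A_\alpha^{+},A_\alpha^{ - }$ ($\alpha\in\{0,1\}^*$), and let $\mathrm{eval}$, the group $G$, the map $w\mapsto[w]$, the endomorphisms $\mathrm{sh}_\gamma$ and the map $\mathrm{Cc}:T\to G$ be as in the context. Then for every term $t\in T$ and every word $w\in\mathcal{W}$ such that $t\cdot\mathrm{eval}(w)$ is defined, one has in $G$ $$\mathrm{Cc}(t\cdot\mathrm{eval}(w))=\mathrm{Cc}(t)\cdot\mathrm{sh}_0([w]).$$
   Context: Addresses are finite words over $\{0,1\}$ ($0$ = left, $1$ = right, $\varepsilon$ = empty address = root); $t/\alpha$ denotes the subterm of $t$ at address $\alpha$ when it exists. Two addresses $\alpha,\beta$ are incomparable if there is $\gamma$ such that $\gamma0$ is a prefix of $\alpha$ and $\gamma1$ a prefix of $\beta$, or vice versa. Partial operators on terms: $\Sigma^+_\alpha$ is defined on $t$ iff $t/\alpha$ has the form $t_1*(t_2\,\square\,t_3)$ with $\square\in\{*,\circ\}$, and it replaces this subterm by $(t_1*t_2)\,\square\,(t_1*t_3)$; $A^+_\alpha$ is defined on $t$ iff $t/\alpha$ has the form $t_1*(t_2*t_3)$, and it replaces this subterm by $(t_1\circ t_2)*t_3$; $\Sigma^-_\alpha$, $A^-_\alpha$ are the inverse partial maps. Operators act on the right, $t\cdot f$ is the image of $t$ under $f$; for a word $w=\ell_1\cdots\ell_n\in\mathcal{W}$,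 $\mathrm{eval}(w)$ is the partial map "apply $\ell_1$, then $\ell_2$, ..., then $\ell_n$". $G$ is the group generated by elements $\Sigma_\alpha, A_\alpha$ ($\alpha\in\{0,1\}^*$) subject to the following relations, where $X,Y$ range over $\{\Sigma,A\}$, $\alpha,\delta$ over all addresses and group products are written left to right: (1) $X_\alpha Y_\beta=Y_\beta X_\alpha$ for $\alpha,\beta$ incomparable; (2) $X_{\alpha0\delta}\Sigma_\alpha=\Sigma_\alpha X_{\alpha00\delta}X_{\alpha10\delta}$; (3) $X_{\alpha10\delta}\Sigma_\alpha=\Sigma_\alpha X_{\alpha01\delta}$; (4) $X_{\alpha11\delta}\Sigma_\alpha=\Sigma_\alpha X_{\alpha11\delta}$; (5) $X_{\alpha0\delta}A_\alpha=A_\alpha X_{\alpha00\delta}$; (6) $X_{\alpha10\delta}A_\alpha=A_\alpha X_{\alpha01\delta}$; (7) $X_{\alpha11\delta}A_\alpha=A_\alpha X_{\alpha1\delta}$; (8) $\Sigma_\alpha\Sigma_{\alpha1}\Sigma_\alpha=\Sigma_{\alpha1}\Sigma_\alpha\Sigma_{\alpha1}\Sigma_{\alpha0}$; (9) $\Sigma_\alpha\Sigma_{\alpha1}A_\alpha=A_{\alpha1}\Sigma_\alpha\Sigma_{\alpha0}$; (10) $A_\alpha\Sigma_\alpha=\Sigma_{\alpha1}\Sigma_\alpha A_{\alpha1}A_{\alpha0}$. For $w\in\mathcal{W}$, $[w]\in G$ is the image of $w$ under the monoid morphism sending $\Sigma^{\pm}_\alpha\mapsto\Sigma_\alpha^{\pm1}$,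 $A^{\pm}_\alpha\mapsto A_\alpha^{\pm1}$. For an address $\gamma$, $\mathrm{sh}_\gamma$ is the endomorphism of $G$ with $\Sigma_\alpha\mapsto\Sigma_{\gamma\alpha}$, $A_\alpha\mapsto A_{\gamma\alpha}$ (well defined since the relations are preserved by prefixing all addresses with $\gamma$). $\mathrm{Cc}:T\to G$ is defined inductively by $\mathrm{Cc}(x)=1$, $\mathrm{Cc}(t_1*t_2)=\mathrm{Cc}(t_1)\cdot\mathrm{sh}_1(\mathrm{Cc}(t_2))\cdot\Sigma_\varepsilon\cdot\mathrm{sh}_1(\mathrm{Cc}(t_1))^{ -1}$, and $\mathrm{Cc}(t_1\circ t_2)=\mathrm{Cc}(t_1)\cdot\mathrm{sh}_1(\mathrm{Cc}(t_2))\cdot A_\varepsilon$. -}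

module Defs where

open import Data.List using (List; []; _∷_; _++_; map; reverse)
open import Data.Product using (Σ-syntax; _×_; _,_)
open import Relation.Binary.PropositionalEquality using (_≡_)

data Bit : Set where
  b0 b1 : Bit

Addr : Set
Addr = List Bit

infixr 6 _*_ _∘_
data T : Set where
  x   : T
  _*_ : T → T → T
  _∘_ : T → T → T

data LocΣ : T → T → Set where
  σ* : ∀ t₁ t₂ t₃ → LocΣ (t₁ * (t₂ * t₃)) ((t₁ * t₂) * (t₁ * t₃))
  σ∘ : ∀ t₁ t₂ t₃ → LocΣ (t₁ * (t₂ ∘ t₃)) ((t₁ * t₂) ∘ (t₁ * t₃))

data LocA : T → T → Set where
  a* : ∀ t₁ t₂ t₃ → LocA (t₁ * (t₂ * t₃)) ((t₁ ∘ t₂) * t₃)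

-- Applying a local step at address α (graph of the partial map).
data AtAddr (R : T → T → Set) : Addr → T → T → Set where
  here : ∀ {t t'} → R t t' → AtAddr R [] t t'
  l*   : ∀ {α t₁ t₁' t₂} → AtAddr R α t₁ t₁' → AtAddr R (b0 ∷ α) (t₁ * t₂) (t₁' * t₂)
  r*   : ∀ {α t₁ t₂ t₂'} → AtAddr R α t₂ t₂' → AtAddr R (b1 ∷ α) (t₁ * t₂) (t₁ * t₂')
  l∘   : ∀ {α t₁ t₁' t₂} → AtAddr R α t₁ t₁' → AtAddr R (b0 ∷ α) (t₁ ∘ t₂) (t₁' ∘ t₂)
  r∘   : ∀ {α t₁ t₂ t₂'} → AtAddr R α t₂ t₂' → AtAddr R (b1 ∷ α) (t₁ ∘ t₂) (t₁ ∘ t₂')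

data Letter : Set where
  Σ⁺ Σ⁻ A⁺ A⁻ : Addr → Letter

W : Set
W = List Letter

-- Step ℓ t t'  :  t · ℓ is defined and equals t'.
-- The "−" operators are the inverse partial maps of the "+" ones.
Step : Letter → T → T → Set
Step (Σ⁺ α) t t' = AtAddr LocΣ α t t'
Step (Σ⁻ α) t t' = AtAddr LocΣ α t' t
Step (A⁺ α) t t' = AtAddr LocA α t t'
Step (A⁻ α) t t' = AtAddr LocA α t' t

-- Eval w t t'  :  t · eval(w) is defined and equals t'
-- (apply the letters of w from left to right).
data Eval : W → T → T → Set where
  nil  : ∀ {t} → Eval [] t t
  cons : ∀ {ℓ w t t' t''} → Step ℓ t t' → Eval w t' t'' → Eval (ℓ ∷ w) t t''

-- Elements are represented by words in the generators and their inverses;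
-- equality in G is the congruence _≈_ below (free-group cancellation plus
-- the defining relations, closed under concatenation).

data Op : Set where
  Σ A : Op

data Sgn : Set where
  pos neg : Sgn

flip : Sgn → Sgn
flip pos = neg
flip neg = pos

GLit : Set
GLit = Sgn × Op × Addr

GW : Set
GW = List GLit

gen : Op → Addr → GW
gen X α = (pos , X , α) ∷ []

inv : GW → GW
inv w = reverse (map (λ { (s , X , α) → (flip s , X , α) }) w)

data Incomp : Addr → Addr → Set where
  inc₀₁ : ∀ γ p q → Incomp (γ ++ b0 ∷ p) (γ ++ b1 ∷ q)
  inc₁₀ : ∀ γ p q → Incomp (γ ++ b1 ∷ p) (γ ++ b0 ∷ q)

-- the defining relations (1)-(10); group products written left to right
data Rel : GW → GW → Set where
  r1  : ∀ X Y α β → Incomp α β → Rel (gen X α ++ gen Y β) (gen Y β ++ gen X α)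
  r2  : ∀ X α δ → Rel (gen X (α ++ b0 ∷ δ) ++ gen Σ α)
                      (gen Σ α ++ gen X (α ++ b0 ∷ b0 ∷ δ) ++ gen X (α ++ b1 ∷ b0 ∷ δ))
  r3  : ∀ X α δ → Rel (gen X (α ++ b1 ∷ b0 ∷ δ) ++ gen Σ α)
                      (gen Σ α ++ gen X (α ++ b0 ∷ b1 ∷ δ))
  r4  : ∀ X α δ → Rel (gen X (α ++ b1 ∷ b1 ∷ δ) ++ gen Σ α)
                      (gen Σ α ++ gen X (α ++ b1 ∷ b1 ∷ δ))
  r5  : ∀ X α δ → Rel (gen X (α ++ b0 ∷ δ) ++ gen A α)
                      (gen A α ++ gen X (α ++ b0 ∷ b0 ∷ δ))
  r6  : ∀ X α δ → Rel (gen X (α ++ b1 ∷ b0 ∷ δ) ++ gen A α)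
                      (gen A α ++ gen X (α ++ b0 ∷ b1 ∷ δ))
  r7  : ∀ X α δ → Rel (gen X (α ++ b1 ∷ b1 ∷ δ) ++ gen A α)
                      (gen A α ++ gen X (α ++ b1 ∷ δ))
  r8  : ∀ α → Rel (gen Σ α ++ gen Σ (α ++ b1 ∷ []) ++ gen Σ α)
                  (gen Σ (α ++ b1 ∷ []) ++ gen Σ α ++ gen Σ (α ++ b1 ∷ []) ++ gen Σ (α ++ b0 ∷ []))
  r9  : ∀ α → Rel (gen Σ α ++ gen Σ (α ++ b1 ∷ []) ++ gen A α)
                  (gen A (α ++ b1 ∷ []) ++ gen Σ α ++ gen Σ (α ++ b0 ∷ []))
  r10 : ∀ α → Rel (gen A α ++ gen Σ α)
                  (gen Σ (α ++ b1 ∷ []) ++ gen Σ α ++ gen A (α ++ b1 ∷ []) ++ gen A (α ++ b0 ∷ []))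

infix 4 _≈_
data _≈_ : GW → GW → Set where
  ≈-refl  : ∀ {u} → u ≈ u
  ≈-sym   : ∀ {u v} → u ≈ v → v ≈ u
  ≈-trans : ∀ {u v w} → u ≈ v → v ≈ w → u ≈ w
  ≈-cong  : ∀ {u u' v v'} → u ≈ u' → v ≈ v' → u ++ v ≈ u' ++ v'
  ≈-cancel : ∀ s X α → (s , X , α) ∷ (flip s , X , α) ∷ [] ≈ []
  ≈-rel   : ∀ {u v} → Rel u v → u ≈ v

⟦_⟧ : W → GW
⟦ [] ⟧ = []
⟦ Σ⁺ α ∷ w ⟧ = (pos , Σ , α) ∷ ⟦ w ⟧
⟦ Σ⁻ α ∷ w ⟧ = (neg , Σ , α) ∷ ⟦ w ⟧
⟦ A⁺ α ∷ w ⟧ = (pos , A , α) ∷ ⟦ w ⟧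
⟦ A⁻ α ∷ w ⟧ = (neg , A , α) ∷ ⟦ w ⟧

sh : Addr → GW → GW
sh γ = map (λ { (s , X , α) → (s , X , γ ++ α) })

Cc : T → GW
Cc x = []
Cc (t₁ * t₂) = Cc t₁ ++ sh (b1 ∷ []) (Cc t₂) ++ gen Σ [] ++ inv (sh (b1 ∷ []) (Cc t₁))
Cc (t₁ ∘ t₂) = Cc t₁ ++ sh (b1 ∷ []) (Cc t₂) ++ gen A []

{-# OPTIONS --safe #-}
module Submission where

open import Defs
open import Data.List using (List; []; _∷_; _++_; [_]; map; reverse)
open import Data.List.Properties using (++-assoc; ++-identityʳ; map-++; map-∘; reverse-++; reverse-map; unfold-reverse)
open import Data.Product using (_,_)
open import Relation.Binary.Bundles using (Setoid)
open import Relation.Binary.PropositionalEquality using (_≡_; refl; sym; trans; cong; cong₂; module ≡-Reasoning)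
import Relation.Binary.Reasoning.Setoid as SetoidReasoning

-- A rule applied at the root multiplies Cc on the right by Σ₀ or A₀: after sliding the shifted
-- words past the root generators with relations (1), (4) and (7), this is exactly relation
-- (8), (9) or (10). A rule applied inside a factor is transported to the product by relations
-- (2), (3), (5) and (6), which turn the generator X₀α contributed by a factor into X₀₀α or
-- X₀₁α. Inverse letters follow by solving for Cc t, and words by induction along eval.

≈-setoid : Setoid _ _
≈-setoid = record
  { Carrier       = GW
  ; _≈_           = _≈_
  ; isEquivalence = record { refl = ≈-refl ; sym = ≈-sym ; trans = ≈-trans }
  }

ε ⟨0⟩ ⟨1⟩ ⟨11⟩ : Addr
ε    = []
⟨0⟩  = b0 ∷ []
⟨1⟩  = b1 ∷ []
⟨11⟩ = b1 ∷ b1 ∷ []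

≡⇒≈ : ∀ {u v} → u ≡ v → u ≈ v
≡⇒≈ refl = ≈-refl

++-congˡ : ∀ p {u v} → u ≈ v → p ++ u ≈ p ++ v
++-congˡ p = ≈-cong (≈-refl {p})

++-congʳ : ∀ {u v} k → u ≈ v → u ++ k ≈ v ++ k
++-congʳ k e = ≈-cong e (≈-refl {k})

lit⁻¹ : GLit → GLit
lit⁻¹ (s , X , α) = (flip s , X , α)

flip-involutive : ∀ s → flip (flip s) ≡ s
flip-involutive pos = refl
flip-involutive neg = refl

lit-inverseʳ : ∀ l k → l ∷ lit⁻¹ l ∷ k ≈ k
lit-inverseʳ (s , X , α) k = ++-congʳ k (≈-cancel s X α)

lit-inverseˡ : ∀ l k → lit⁻¹ l ∷ l ∷ k ≈ k
lit-inverseˡ (pos , X , α) k = lit-inverseʳ (neg , X , α) k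
lit-inverseˡ (neg , X , α) k = lit-inverseʳ (pos , X , α) k

inv-∷ : ∀ l u → inv (l ∷ u) ≡ inv u ++ lit⁻¹ l ∷ []
inv-∷ l u = reverse-++ (lit⁻¹ l ∷ []) (map lit⁻¹ u)

inv-++ : ∀ u v → inv (u ++ v) ≡ inv v ++ inv u
inv-++ u v = trans (cong reverse (map-++ lit⁻¹ u v)) (reverse-++ (map lit⁻¹ u) (map lit⁻¹ v))

inv-involutive : ∀ u → inv (inv u) ≡ u
inv-involutive [] = refl
inv-involutive (l@(s , X , α) ∷ u) =
  trans (cong inv (inv-∷ l u))
  (trans (inv-++ (inv u) (lit⁻¹ l ∷ []))
  (cong₂ (λ s′ u′ → (s′ , X , α) ∷ u′) (flip-involutive s) (inv-involutive u)))

sh-++ : ∀ γ u v → sh γ (u ++ v) ≡ sh γ u ++ sh γ v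
sh-++ γ = map-++ _

sh-sh : ∀ γ δ u → sh γ (sh δ u) ≡ sh (γ ++ δ) u
sh-sh γ δ [] = refl
sh-sh γ δ ((s , X , α) ∷ u) = cong₂ (λ β u′ → (s , X , β) ∷ u′) (sym (++-assoc γ δ α)) (sh-sh γ δ u)

sh-ε : ∀ u → sh [] u ≡ u
sh-ε [] = refl
sh-ε (l ∷ u) = cong (l ∷_) (sh-ε u)

-- flipping the sign and shifting the address of a letter commute definitionally
inv-sh : ∀ γ u → inv (sh γ u) ≡ sh γ (inv u)
inv-sh γ u =
  trans (cong reverse (trans (sym (map-∘ u)) (map-∘ u))) (sym (reverse-map _ (map lit⁻¹ u)))

inverseʳ : ∀ u k → u ++ inv u ++ k ≈ k
inverseʳ [] k = ≈-refl
inverseʳ (l ∷ u) k = begin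
  l ∷ u ++ inv (l ∷ u) ++ k             ≡⟨ cong (λ v → l ∷ u ++ v ++ k) (inv-∷ l u) ⟩
  l ∷ u ++ (inv u ++ [ lit⁻¹ l ]) ++ k  ≡⟨ cong (λ v → l ∷ u ++ v) (++-assoc (inv u) _ k) ⟩
  l ∷ u ++ inv u ++ lit⁻¹ l ∷ k         ≈⟨ ++-congˡ [ l ] (inverseʳ u (lit⁻¹ l ∷ k)) ⟩
  l ∷ lit⁻¹ l ∷ k                       ≈⟨ lit-inverseʳ l k ⟩
  k                                     ∎
  where open SetoidReasoning ≈-setoid

inverseˡ : ∀ u k → inv u ++ u ++ k ≈ k
inverseˡ [] k = ≈-refl
inverseˡ (l ∷ u) k = begin
  inv (l ∷ u) ++ l ∷ u ++ k             ≡⟨ cong (_++ l ∷ u ++ k) (inv-∷ l u) ⟩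
  (inv u ++ [ lit⁻¹ l ]) ++ l ∷ u ++ k  ≡⟨ ++-assoc (inv u) _ _ ⟩
  inv u ++ lit⁻¹ l ∷ l ∷ u ++ k         ≈⟨ ++-congˡ (inv u) (lit-inverseˡ l (u ++ k)) ⟩
  inv u ++ u ++ k                       ≈⟨ inverseˡ u k ⟩
  k                                     ∎
  where open SetoidReasoning ≈-setoid

inv-cong : ∀ {u v} → u ≈ v → inv u ≈ inv v
inv-cong {u} {v} u≈v = begin
  inv u                     ≡⟨ ++-identityʳ (inv u) ⟨
  inv u ++ []               ≈⟨ ++-congˡ (inv u) (inverseʳ v []) ⟨
  inv u ++ v ++ inv v ++ [] ≈⟨ ++-congˡ (inv u) (++-congʳ (inv v ++ []) u≈v) ⟨
  inv u ++ u ++ inv v ++ [] ≈⟨ inverseˡ u (inv v ++ []) ⟩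
  inv v ++ []               ≡⟨ ++-identityʳ (inv v) ⟩
  inv v                     ∎
  where open SetoidReasoning ≈-setoid

Incomp-sh : ∀ γ {α β} → Incomp α β → Incomp (γ ++ α) (γ ++ β)
Incomp-sh γ (inc₀₁ δ p q)
  rewrite sym (++-assoc γ δ (b0 ∷ p)) | sym (++-assoc γ δ (b1 ∷ q))
  = inc₀₁ (γ ++ δ) p q
Incomp-sh γ (inc₁₀ δ p q)
  rewrite sym (++-assoc γ δ (b1 ∷ p)) | sym (++-assoc γ δ (b0 ∷ q))
  = inc₁₀ (γ ++ δ) p q

sh-Rel : ∀ γ {u v} → Rel u v → sh γ u ≈ sh γ v
sh-Rel γ (r1 X Y α β i) = ≈-rel (r1 X Y (γ ++ α) (γ ++ β) (Incomp-sh γ i))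
sh-Rel γ (r2 X α δ)
  rewrite sym (++-assoc γ α (b0 ∷ δ)) | sym (++-assoc γ α (b0 ∷ b0 ∷ δ)) | sym (++-assoc γ α (b1 ∷ b0 ∷ δ))
  = ≈-rel (r2 X (γ ++ α) δ)
sh-Rel γ (r3 X α δ)
  rewrite sym (++-assoc γ α (b1 ∷ b0 ∷ δ)) | sym (++-assoc γ α (b0 ∷ b1 ∷ δ))
  = ≈-rel (r3 X (γ ++ α) δ)
sh-Rel γ (r4 X α δ) rewrite sym (++-assoc γ α (b1 ∷ b1 ∷ δ)) = ≈-rel (r4 X (γ ++ α) δ)
sh-Rel γ (r5 X α δ)
  rewrite sym (++-assoc γ α (b0 ∷ δ)) | sym (++-assoc γ α (b0 ∷ b0 ∷ δ))
  = ≈-rel (r5 X (γ ++ α) δ)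
sh-Rel γ (r6 X α δ)
  rewrite sym (++-assoc γ α (b1 ∷ b0 ∷ δ)) | sym (++-assoc γ α (b0 ∷ b1 ∷ δ))
  = ≈-rel (r6 X (γ ++ α) δ)
sh-Rel γ (r7 X α δ)
  rewrite sym (++-assoc γ α (b1 ∷ b1 ∷ δ)) | sym (++-assoc γ α (b1 ∷ δ))
  = ≈-rel (r7 X (γ ++ α) δ)
sh-Rel γ (r8 α)
  rewrite sym (++-assoc γ α (b1 ∷ [])) | sym (++-assoc γ α (b0 ∷ []))
  = ≈-rel (r8 (γ ++ α))
sh-Rel γ (r9 α)
  rewrite sym (++-assoc γ α (b1 ∷ [])) | sym (++-assoc γ α (b0 ∷ []))
  = ≈-rel (r9 (γ ++ α))
sh-Rel γ (r10 α)
  rewrite sym (++-assoc γ α (b1 ∷ [])) | sym (++-assoc γ α (b0 ∷ []))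
  = ≈-rel (r10 (γ ++ α))

sh-cong : ∀ γ {u v} → u ≈ v → sh γ u ≈ sh γ v
sh-cong γ ≈-refl = ≈-refl
sh-cong γ (≈-sym e) = ≈-sym (sh-cong γ e)
sh-cong γ (≈-trans e f) = ≈-trans (sh-cong γ e) (sh-cong γ f)
sh-cong γ (≈-cong {u} {u′} {v} {v′} e f) =
  ≈-trans (≡⇒≈ (sh-++ γ u v)) (≈-trans (≈-cong (sh-cong γ e) (sh-cong γ f)) (≡⇒≈ (sym (sh-++ γ u′ v′))))
sh-cong γ (≈-cancel s X α) = ≈-cancel s X (γ ++ α)
sh-cong γ (≈-rel r) = sh-Rel γ r

Commute : GLit → GLit → Set
Commute l l′ = l ∷ l′ ∷ [] ≈ l′ ∷ l ∷ []

conjugate-inverse : ∀ {l g g′ l′} → l ∷ g ∷ [] ≈ g′ ∷ l′ ∷ [] → lit⁻¹ l ∷ g′ ∷ [] ≈ g ∷ lit⁻¹ l′ ∷ []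
conjugate-inverse {l} {g} {g′} {l′} lg≈g′l′ = begin
  lit⁻¹ l ∷ g′ ∷ []                     ≈⟨ ++-congˡ (lit⁻¹ l ∷ g′ ∷ []) (lit-inverseʳ l′ []) ⟨
  lit⁻¹ l ∷ g′ ∷ l′ ∷ lit⁻¹ l′ ∷ []     ≈⟨ ++-congˡ [ lit⁻¹ l ] (++-congʳ [ lit⁻¹ l′ ] lg≈g′l′) ⟨
  lit⁻¹ l ∷ l ∷ g ∷ lit⁻¹ l′ ∷ []       ≈⟨ lit-inverseˡ l _ ⟩
  g ∷ lit⁻¹ l′ ∷ []                     ∎
  where open SetoidReasoning ≈-setoid

incomparable-commute⁺ : ∀ {α β} → Incomp α β → ∀ s X Y → Commute (s , X , α) (pos , Y , β)
incomparable-commute⁺ {α} {β} i pos X Y = ≈-rel (r1 X Y α β i)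
incomparable-commute⁺ i neg X Y = conjugate-inverse (incomparable-commute⁺ i pos X Y)

incomparable-commute : ∀ {α β} → Incomp α β → ∀ s s′ X Y → Commute (s , X , α) (s′ , Y , β)
incomparable-commute i s pos X Y = incomparable-commute⁺ i s X Y
incomparable-commute i s neg X Y = ≈-sym (conjugate-inverse (≈-sym (incomparable-commute⁺ i s X Y)))

Intertwines : GLit → Addr → Addr → Set
Intertwines g γ₁ γ₂ = ∀ s X α → (s , X , γ₁ ++ α) ∷ g ∷ [] ≈ g ∷ (s , X , γ₂ ++ α) ∷ []

intertwines-from-generators : ∀ {g γ₁ γ₂} → (∀ X α → gen X (γ₁ ++ α) ++ [ g ] ≈ g ∷ gen X (γ₂ ++ α))
                            → Intertwines g γ₁ γ₂
intertwines-from-generators h pos X α = h X α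
intertwines-from-generators h neg X α = conjugate-inverse (h X α)

intertwine : ∀ {g γ₁ γ₂} → Intertwines g γ₁ γ₂ → ∀ u k → sh γ₁ u ++ g ∷ k ≈ g ∷ sh γ₂ u ++ k
intertwine h [] k = ≈-refl
intertwine {γ₁ = γ₁} h ((s , X , α) ∷ u) k =
  ≈-trans (++-congˡ [ (s , X , γ₁ ++ α) ] (intertwine h u k)) (++-congʳ (sh _ u ++ k) (h s X α))

Σε-intertwines-11-11 : Intertwines (pos , Σ , ε) ⟨11⟩ ⟨11⟩
Σε-intertwines-11-11 = intertwines-from-generators (λ X α → ≈-rel (r4 X ε α))

Aε-intertwines-11-1 : Intertwines (pos , A , ε) ⟨11⟩ ⟨1⟩
Aε-intertwines-11-1 = intertwines-from-generators (λ X α → ≈-rel (r7 X ε α))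

left-intertwines-right : ∀ Y δ γ → Intertwines (pos , Y , b0 ∷ δ) (b1 ∷ γ) (b1 ∷ γ)
left-intertwines-right Y δ γ s X α = incomparable-commute (inc₁₀ [] (γ ++ α) δ) s pos X Y

-- Words are handled as lists of atoms: letters, and shifted, possibly inverted, copies of
-- arbitrary words. Normalising an Expr to such a list absorbs associativity and the interaction
-- of sh and inv with concatenation, so the computations below only record uses of relations.
signed : Sgn → GW → GW
signed pos u = u
signed neg u = inv u

data Atom : Set where
  lit     : GLit → Atom
  shifted : Sgn → Addr → GW → Atom

evalAtom : Atom → GW
evalAtom (lit l)         = [ l ]
evalAtom (shifted s γ u) = sh γ (signed s u)

evalAtoms : List Atom → GW
evalAtoms []       = []
evalAtoms (a ∷ as) = evalAtom a ++ evalAtoms as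

evalAtoms-++ : ∀ as bs → evalAtoms (as ++ bs) ≡ evalAtoms as ++ evalAtoms bs
evalAtoms-++ []       bs = refl
evalAtoms-++ (a ∷ as) bs = trans (cong (evalAtom a ++_) (evalAtoms-++ as bs)) (sym (++-assoc (evalAtom a) _ _))

infixr 5 _⊕_
data Expr : Set where
  word    : GW → Expr
  letter  : GLit → Expr
  _⊕_     : Expr → Expr → Expr
  shift   : Addr → Expr → Expr
  inverse : Expr → Expr

evalExpr : Expr → GW
evalExpr (word u)    = u
evalExpr (letter l)  = [ l ]
evalExpr (e ⊕ f)     = evalExpr e ++ evalExpr f
evalExpr (shift γ e) = sh γ (evalExpr e)
evalExpr (inverse e) = inv (evalExpr e)

shiftAtom : Addr → Atom → Atom
shiftAtom γ (lit (s , X , α))  = lit (s , X , γ ++ α)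
shiftAtom γ (shifted s δ u)    = shifted s (γ ++ δ) u

invAtom : Atom → Atom
invAtom (lit l)         = lit (lit⁻¹ l)
invAtom (shifted s δ u) = shifted (flip s) δ u

normalise : Expr → List Atom
normalise (word u)    = [ shifted pos [] u ]
normalise (letter l)  = [ lit l ]
normalise (e ⊕ f)     = normalise e ++ normalise f
normalise (shift γ e) = map (shiftAtom γ) (normalise e)
normalise (inverse e) = reverse (map invAtom (normalise e))

shiftAtom-sound : ∀ γ a → evalAtom (shiftAtom γ a) ≡ sh γ (evalAtom a)
shiftAtom-sound γ (lit (s , X , α))  = refl
shiftAtom-sound γ (shifted s δ u)    = sym (sh-sh γ δ (signed s u))

invAtom-sound : ∀ a → evalAtom (invAtom a) ≡ inv (evalAtom a)
invAtom-sound (lit l)           = refl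
invAtom-sound (shifted pos δ u) = sym (inv-sh δ u)
invAtom-sound (shifted neg δ u) = trans (cong (sh δ) (sym (inv-involutive u))) (sym (inv-sh δ (inv u)))

shiftAtoms-sound : ∀ γ as → evalAtoms (map (shiftAtom γ) as) ≡ sh γ (evalAtoms as)
shiftAtoms-sound γ []       = refl
shiftAtoms-sound γ (a ∷ as) =
  trans (cong₂ _++_ (shiftAtom-sound γ a) (shiftAtoms-sound γ as)) (sym (sh-++ γ (evalAtom a) (evalAtoms as)))

invAtoms-sound : ∀ as → evalAtoms (reverse (map invAtom as)) ≡ inv (evalAtoms as)
invAtoms-sound []       = refl
invAtoms-sound (a ∷ as) = begin
  evalAtoms (reverse (invAtom a ∷ map invAtom as))
    ≡⟨ cong evalAtoms (unfold-reverse (invAtom a) (map invAtom as)) ⟩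
  evalAtoms (reverse (map invAtom as) ++ [ invAtom a ])
    ≡⟨ evalAtoms-++ (reverse (map invAtom as)) [ invAtom a ] ⟩
  evalAtoms (reverse (map invAtom as)) ++ evalAtom (invAtom a) ++ []
    ≡⟨ cong₂ _++_ (invAtoms-sound as) (trans (++-identityʳ _) (invAtom-sound a)) ⟩
  inv (evalAtoms as) ++ inv (evalAtom a)
    ≡⟨ inv-++ (evalAtom a) (evalAtoms as) ⟨
  inv (evalAtom a ++ evalAtoms as)
    ∎
  where open ≡-Reasoning

normalise-sound : ∀ e → evalAtoms (normalise e) ≡ evalExpr e
normalise-sound (word u)    = trans (++-identityʳ (sh [] u)) (sh-ε u)
normalise-sound (letter l)  = refl
normalise-sound (e ⊕ f)     =
  trans (evalAtoms-++ (normalise e) (normalise f)) (cong₂ _++_ (normalise-sound e) (normalise-sound f))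
normalise-sound (shift γ e) = trans (shiftAtoms-sound γ (normalise e)) (cong (sh γ) (normalise-sound e))
normalise-sound (inverse e) = trans (invAtoms-sound (normalise e)) (cong inv (normalise-sound e))

-- A record rather than a synonym, so that the steps of a chain are matched on their atom lists
-- (evalAtoms is not injective, so a synonym leaves them unsolved).
infix 4 _≋_
record _≋_ (as bs : List Atom) : Set where
  constructor ≋-intro
  field ≋⇒≈ : evalAtoms as ≈ evalAtoms bs

infixr 4 _▹_
_▹_ : ∀ {as bs cs} → as ≋ bs → bs ≋ cs → as ≋ cs
≋-intro p ▹ ≋-intro q = ≋-intro (≈-trans p q)

at : ∀ pre as bs post → evalAtoms as ≈ evalAtoms bs → pre ++ as ++ post ≋ pre ++ bs ++ post
at pre as bs post as≈bs = ≋-intro (begin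
  evalAtoms (pre ++ as ++ post)                    ≡⟨ evalAtoms-++₃ as ⟩
  evalAtoms pre ++ evalAtoms as ++ evalAtoms post  ≈⟨ ++-congˡ (evalAtoms pre) (++-congʳ (evalAtoms post) as≈bs) ⟩
  evalAtoms pre ++ evalAtoms bs ++ evalAtoms post  ≡⟨ evalAtoms-++₃ bs ⟨
  evalAtoms (pre ++ bs ++ post)                    ∎)
  where
  open SetoidReasoning ≈-setoid
  evalAtoms-++₃ : ∀ cs → evalAtoms (pre ++ cs ++ post) ≡ evalAtoms pre ++ evalAtoms cs ++ evalAtoms post
  evalAtoms-++₃ cs = trans (evalAtoms-++ pre (cs ++ post)) (cong (evalAtoms pre ++_) (evalAtoms-++ cs post))

by-normalising : ∀ e f → normalise e ≋ normalise f → evalExpr e ≈ evalExpr f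
by-normalising e f (≋-intro p) =
  ≈-trans (≡⇒≈ (sym (normalise-sound e))) (≈-trans p (≡⇒≈ (normalise-sound f)))

cancel-shifted : ∀ γ u → evalAtoms (shifted neg γ u ∷ shifted pos γ u ∷ []) ≈ []
cancel-shifted γ u =
  ≈-trans (≡⇒≈ (cong (_++ sh γ u ++ []) (sym (inv-sh γ u)))) (inverseˡ (sh γ u) [])

intertwine-shifted : ∀ {g γ₁ γ₂} → Intertwines g γ₁ γ₂ → ∀ s u →
                     evalAtoms (shifted s γ₁ u ∷ lit g ∷ []) ≈ evalAtoms (lit g ∷ shifted s γ₂ u ∷ [])
intertwine-shifted h s u = intertwine h (signed s u) []

sh⁺ sh⁻ : Addr → GW → Atom
sh⁺ = shifted pos
sh⁻ = shifted neg

g⁺ g⁻ : Op → Addr → Atom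
g⁺ X α = lit (pos , X , α)
g⁻ X α = lit (neg , X , α)

infixl 6 _⋆_ _⊙_ _⋆ᴱ_ _⊙ᴱ_
_⋆_ _⊙_ : GW → GW → GW
a ⋆ b = a ++ sh ⟨1⟩ b ++ gen Σ ε ++ inv (sh ⟨1⟩ a)
a ⊙ b = a ++ sh ⟨1⟩ b ++ gen A ε

_⋆ᴱ_ _⊙ᴱ_ : Expr → Expr → Expr
a ⋆ᴱ b = a ⊕ shift ⟨1⟩ b ⊕ letter (pos , Σ , ε) ⊕ inverse (shift ⟨1⟩ a)
a ⊙ᴱ b = a ⊕ shift ⟨1⟩ b ⊕ letter (pos , A , ε)

⋆-cong : ∀ {a a′ b b′} → a ≈ a′ → b ≈ b′ → a ⋆ b ≈ a′ ⋆ b′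
⋆-cong a≈a′ b≈b′ =
  ≈-cong a≈a′ (≈-cong (sh-cong ⟨1⟩ b≈b′) (++-congˡ (gen Σ ε) (inv-cong (sh-cong ⟨1⟩ a≈a′))))

⊙-cong : ∀ {a a′ b b′} → a ≈ a′ → b ≈ b′ → a ⊙ b ≈ a′ ⊙ b′
⊙-cong a≈a′ b≈b′ = ≈-cong a≈a′ (++-congʳ (gen A ε) (sh-cong ⟨1⟩ b≈b′))

⋆-distribˡ-⋆ : ∀ a b c → (a ⋆ b) ⋆ (a ⋆ c) ≈ a ⋆ (b ⋆ c) ++ gen Σ ⟨0⟩
⋆-distribˡ-⋆ a b c = by-normalising
  ((word a ⋆ᴱ word b) ⋆ᴱ (word a ⋆ᴱ word c)) (word a ⋆ᴱ (word b ⋆ᴱ word c) ⊕ letter (pos , Σ , ⟨0⟩))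
  ( at (sh⁺ ε a ∷ sh⁺ ⟨1⟩ b ∷ g⁺ Σ ε ∷ [])
       (sh⁻ ⟨1⟩ a ∷ sh⁺ ⟨1⟩ a ∷ []) []
       (sh⁺ ⟨11⟩ c ∷ g⁺ Σ ⟨1⟩ ∷ sh⁻ ⟨11⟩ a ∷ g⁺ Σ ε ∷ sh⁺ ⟨11⟩ a ∷ g⁻ Σ ⟨1⟩ ∷ sh⁻ ⟨11⟩ b ∷ sh⁻ ⟨1⟩ a ∷ [])
       (cancel-shifted ⟨1⟩ a)
  ▹ at (sh⁺ ε a ∷ sh⁺ ⟨1⟩ b ∷ g⁺ Σ ε ∷ sh⁺ ⟨11⟩ c ∷ g⁺ Σ ⟨1⟩ ∷ [])
       (sh⁻ ⟨11⟩ a ∷ g⁺ Σ ε ∷ []) (g⁺ Σ ε ∷ sh⁻ ⟨11⟩ a ∷ [])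
       (sh⁺ ⟨11⟩ a ∷ g⁻ Σ ⟨1⟩ ∷ sh⁻ ⟨11⟩ b ∷ sh⁻ ⟨1⟩ a ∷ [])
       (intertwine-shifted Σε-intertwines-11-11 neg a)
  ▹ at (sh⁺ ε a ∷ sh⁺ ⟨1⟩ b ∷ g⁺ Σ ε ∷ sh⁺ ⟨11⟩ c ∷ g⁺ Σ ⟨1⟩ ∷ g⁺ Σ ε ∷ [])
       (sh⁻ ⟨11⟩ a ∷ sh⁺ ⟨11⟩ a ∷ []) []
       (g⁻ Σ ⟨1⟩ ∷ sh⁻ ⟨11⟩ b ∷ sh⁻ ⟨1⟩ a ∷ [])
       (cancel-shifted ⟨11⟩ a)
  ▹ at (sh⁺ ε a ∷ sh⁺ ⟨1⟩ b ∷ [])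
       (g⁺ Σ ε ∷ sh⁺ ⟨11⟩ c ∷ []) (sh⁺ ⟨11⟩ c ∷ g⁺ Σ ε ∷ [])
       (g⁺ Σ ⟨1⟩ ∷ g⁺ Σ ε ∷ g⁻ Σ ⟨1⟩ ∷ sh⁻ ⟨11⟩ b ∷ sh⁻ ⟨1⟩ a ∷ [])
       (≈-sym (intertwine-shifted Σε-intertwines-11-11 pos c))
  ▹ at (sh⁺ ε a ∷ sh⁺ ⟨1⟩ b ∷ sh⁺ ⟨11⟩ c ∷ [])
       (g⁺ Σ ε ∷ g⁺ Σ ⟨1⟩ ∷ g⁺ Σ ε ∷ []) (g⁺ Σ ⟨1⟩ ∷ g⁺ Σ ε ∷ g⁺ Σ ⟨1⟩ ∷ g⁺ Σ ⟨0⟩ ∷ [])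
       (g⁻ Σ ⟨1⟩ ∷ sh⁻ ⟨11⟩ b ∷ sh⁻ ⟨1⟩ a ∷ [])
       (≈-rel (r8 ε))
  ▹ at (sh⁺ ε a ∷ sh⁺ ⟨1⟩ b ∷ sh⁺ ⟨11⟩ c ∷ g⁺ Σ ⟨1⟩ ∷ g⁺ Σ ε ∷ g⁺ Σ ⟨1⟩ ∷ [])
       (g⁺ Σ ⟨0⟩ ∷ g⁻ Σ ⟨1⟩ ∷ []) (g⁻ Σ ⟨1⟩ ∷ g⁺ Σ ⟨0⟩ ∷ [])
       (sh⁻ ⟨11⟩ b ∷ sh⁻ ⟨1⟩ a ∷ [])
       (incomparable-commute (inc₀₁ [] [] []) pos neg Σ Σ)
  ▹ at (sh⁺ ε a ∷ sh⁺ ⟨1⟩ b ∷ sh⁺ ⟨11⟩ c ∷ g⁺ Σ ⟨1⟩ ∷ g⁺ Σ ε ∷ [])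
       (g⁺ Σ ⟨1⟩ ∷ g⁻ Σ ⟨1⟩ ∷ []) []
       (g⁺ Σ ⟨0⟩ ∷ sh⁻ ⟨11⟩ b ∷ sh⁻ ⟨1⟩ a ∷ [])
       (≈-cancel pos Σ ⟨1⟩)
  ▹ at (sh⁺ ε a ∷ sh⁺ ⟨1⟩ b ∷ sh⁺ ⟨11⟩ c ∷ g⁺ Σ ⟨1⟩ ∷ g⁺ Σ ε ∷ [])
       (g⁺ Σ ⟨0⟩ ∷ sh⁻ ⟨11⟩ b ∷ []) (sh⁻ ⟨11⟩ b ∷ g⁺ Σ ⟨0⟩ ∷ [])
       (sh⁻ ⟨1⟩ a ∷ [])
       (≈-sym (intertwine-shifted (left-intertwines-right Σ ε ⟨1⟩) neg b))
  ▹ at (sh⁺ ε a ∷ sh⁺ ⟨1⟩ b ∷ sh⁺ ⟨11⟩ c ∷ g⁺ Σ ⟨1⟩ ∷ g⁺ Σ ε ∷ sh⁻ ⟨11⟩ b ∷ [])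
       (g⁺ Σ ⟨0⟩ ∷ sh⁻ ⟨1⟩ a ∷ []) (sh⁻ ⟨1⟩ a ∷ g⁺ Σ ⟨0⟩ ∷ [])
       []
       (≈-sym (intertwine-shifted (left-intertwines-right Σ ε ε) neg a))
  ▹ at (sh⁺ ε a ∷ sh⁺ ⟨1⟩ b ∷ sh⁺ ⟨11⟩ c ∷ g⁺ Σ ⟨1⟩ ∷ [])
       (g⁺ Σ ε ∷ sh⁻ ⟨11⟩ b ∷ []) (sh⁻ ⟨11⟩ b ∷ g⁺ Σ ε ∷ [])
       (sh⁻ ⟨1⟩ a ∷ g⁺ Σ ⟨0⟩ ∷ [])
       (≈-sym (intertwine-shifted Σε-intertwines-11-11 neg b)) )

⋆-distribˡ-⊙ : ∀ a b c → (a ⋆ b) ⊙ (a ⋆ c) ≈ a ⋆ (b ⊙ c) ++ gen Σ ⟨0⟩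
⋆-distribˡ-⊙ a b c = by-normalising
  ((word a ⋆ᴱ word b) ⊙ᴱ (word a ⋆ᴱ word c)) (word a ⋆ᴱ (word b ⊙ᴱ word c) ⊕ letter (pos , Σ , ⟨0⟩))
  ( at (sh⁺ ε a ∷ sh⁺ ⟨1⟩ b ∷ g⁺ Σ ε ∷ [])
       (sh⁻ ⟨1⟩ a ∷ sh⁺ ⟨1⟩ a ∷ []) []
       (sh⁺ ⟨11⟩ c ∷ g⁺ Σ ⟨1⟩ ∷ sh⁻ ⟨11⟩ a ∷ g⁺ A ε ∷ [])
       (cancel-shifted ⟨1⟩ a)
  ▹ at (sh⁺ ε a ∷ sh⁺ ⟨1⟩ b ∷ [])
       (g⁺ Σ ε ∷ sh⁺ ⟨11⟩ c ∷ []) (sh⁺ ⟨11⟩ c ∷ g⁺ Σ ε ∷ [])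
       (g⁺ Σ ⟨1⟩ ∷ sh⁻ ⟨11⟩ a ∷ g⁺ A ε ∷ [])
       (≈-sym (intertwine-shifted Σε-intertwines-11-11 pos c))
  ▹ at (sh⁺ ε a ∷ sh⁺ ⟨1⟩ b ∷ sh⁺ ⟨11⟩ c ∷ g⁺ Σ ε ∷ g⁺ Σ ⟨1⟩ ∷ [])
       (sh⁻ ⟨11⟩ a ∷ g⁺ A ε ∷ []) (g⁺ A ε ∷ sh⁻ ⟨1⟩ a ∷ [])
       []
       (intertwine-shifted Aε-intertwines-11-1 neg a)
  ▹ at (sh⁺ ε a ∷ sh⁺ ⟨1⟩ b ∷ sh⁺ ⟨11⟩ c ∷ [])
       (g⁺ Σ ε ∷ g⁺ Σ ⟨1⟩ ∷ g⁺ A ε ∷ []) (g⁺ A ⟨1⟩ ∷ g⁺ Σ ε ∷ g⁺ Σ ⟨0⟩ ∷ [])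
       (sh⁻ ⟨1⟩ a ∷ [])
       (≈-rel (r9 ε))
  ▹ at (sh⁺ ε a ∷ sh⁺ ⟨1⟩ b ∷ sh⁺ ⟨11⟩ c ∷ g⁺ A ⟨1⟩ ∷ g⁺ Σ ε ∷ [])
       (g⁺ Σ ⟨0⟩ ∷ sh⁻ ⟨1⟩ a ∷ []) (sh⁻ ⟨1⟩ a ∷ g⁺ Σ ⟨0⟩ ∷ [])
       []
       (≈-sym (intertwine-shifted (left-intertwines-right Σ ε ε) neg a)) )

⊙-⋆-assoc : ∀ a b c → (a ⊙ b) ⋆ c ≈ a ⋆ (b ⋆ c) ++ gen A ⟨0⟩
⊙-⋆-assoc a b c = by-normalising
  ((word a ⊙ᴱ word b) ⋆ᴱ word c) (word a ⋆ᴱ (word b ⋆ᴱ word c) ⊕ letter (pos , A , ⟨0⟩))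
  ( at (sh⁺ ε a ∷ sh⁺ ⟨1⟩ b ∷ [])
       (g⁺ A ε ∷ sh⁺ ⟨1⟩ c ∷ []) (sh⁺ ⟨11⟩ c ∷ g⁺ A ε ∷ [])
       (g⁺ Σ ε ∷ g⁻ A ⟨1⟩ ∷ sh⁻ ⟨11⟩ b ∷ sh⁻ ⟨1⟩ a ∷ [])
       (≈-sym (intertwine-shifted Aε-intertwines-11-1 pos c))
  ▹ at (sh⁺ ε a ∷ sh⁺ ⟨1⟩ b ∷ sh⁺ ⟨11⟩ c ∷ [])
       (g⁺ A ε ∷ g⁺ Σ ε ∷ []) (g⁺ Σ ⟨1⟩ ∷ g⁺ Σ ε ∷ g⁺ A ⟨1⟩ ∷ g⁺ A ⟨0⟩ ∷ [])
       (g⁻ A ⟨1⟩ ∷ sh⁻ ⟨11⟩ b ∷ sh⁻ ⟨1⟩ a ∷ [])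
       (≈-rel (r10 ε))
  ▹ at (sh⁺ ε a ∷ sh⁺ ⟨1⟩ b ∷ sh⁺ ⟨11⟩ c ∷ g⁺ Σ ⟨1⟩ ∷ g⁺ Σ ε ∷ g⁺ A ⟨1⟩ ∷ [])
       (g⁺ A ⟨0⟩ ∷ g⁻ A ⟨1⟩ ∷ []) (g⁻ A ⟨1⟩ ∷ g⁺ A ⟨0⟩ ∷ [])
       (sh⁻ ⟨11⟩ b ∷ sh⁻ ⟨1⟩ a ∷ [])
       (incomparable-commute (inc₀₁ [] [] []) pos neg A A)
  ▹ at (sh⁺ ε a ∷ sh⁺ ⟨1⟩ b ∷ sh⁺ ⟨11⟩ c ∷ g⁺ Σ ⟨1⟩ ∷ g⁺ Σ ε ∷ [])
       (g⁺ A ⟨1⟩ ∷ g⁻ A ⟨1⟩ ∷ []) []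
       (g⁺ A ⟨0⟩ ∷ sh⁻ ⟨11⟩ b ∷ sh⁻ ⟨1⟩ a ∷ [])
       (≈-cancel pos A ⟨1⟩)
  ▹ at (sh⁺ ε a ∷ sh⁺ ⟨1⟩ b ∷ sh⁺ ⟨11⟩ c ∷ g⁺ Σ ⟨1⟩ ∷ g⁺ Σ ε ∷ [])
       (g⁺ A ⟨0⟩ ∷ sh⁻ ⟨11⟩ b ∷ []) (sh⁻ ⟨11⟩ b ∷ g⁺ A ⟨0⟩ ∷ [])
       (sh⁻ ⟨1⟩ a ∷ [])
       (≈-sym (intertwine-shifted (left-intertwines-right A ε ⟨1⟩) neg b))
  ▹ at (sh⁺ ε a ∷ sh⁺ ⟨1⟩ b ∷ sh⁺ ⟨11⟩ c ∷ g⁺ Σ ⟨1⟩ ∷ g⁺ Σ ε ∷ sh⁻ ⟨11⟩ b ∷ [])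
       (g⁺ A ⟨0⟩ ∷ sh⁻ ⟨1⟩ a ∷ []) (sh⁻ ⟨1⟩ a ∷ g⁺ A ⟨0⟩ ∷ [])
       []
       (≈-sym (intertwine-shifted (left-intertwines-right A ε ε) neg a))
  ▹ at (sh⁺ ε a ∷ sh⁺ ⟨1⟩ b ∷ sh⁺ ⟨11⟩ c ∷ g⁺ Σ ⟨1⟩ ∷ [])
       (g⁺ Σ ε ∷ sh⁻ ⟨11⟩ b ∷ []) (sh⁻ ⟨11⟩ b ∷ g⁺ Σ ε ∷ [])
       (sh⁻ ⟨1⟩ a ∷ g⁺ A ⟨0⟩ ∷ [])
       (≈-sym (intertwine-shifted Σε-intertwines-11-11 neg b)) )

⋆-appendˡ : ∀ X α a b → (a ++ gen X (b0 ∷ α)) ⋆ b ≈ a ⋆ b ++ gen X (b0 ∷ b0 ∷ α)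
⋆-appendˡ X α a b = by-normalising
  ((word a ⊕ letter (pos , X , b0 ∷ α)) ⋆ᴱ word b) (word a ⋆ᴱ word b ⊕ letter (pos , X , b0 ∷ b0 ∷ α))
  ( at (sh⁺ ε a ∷ [])
       (g⁺ X (b0 ∷ α) ∷ sh⁺ ⟨1⟩ b ∷ []) (sh⁺ ⟨1⟩ b ∷ g⁺ X (b0 ∷ α) ∷ [])
       (g⁺ Σ ε ∷ g⁻ X (b1 ∷ b0 ∷ α) ∷ sh⁻ ⟨1⟩ a ∷ [])
       (≈-sym (intertwine-shifted (left-intertwines-right X α ε) pos b))
  ▹ at (sh⁺ ε a ∷ sh⁺ ⟨1⟩ b ∷ [])
       (g⁺ X (b0 ∷ α) ∷ g⁺ Σ ε ∷ []) (g⁺ Σ ε ∷ g⁺ X (b0 ∷ b0 ∷ α) ∷ g⁺ X (b1 ∷ b0 ∷ α) ∷ [])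
       (g⁻ X (b1 ∷ b0 ∷ α) ∷ sh⁻ ⟨1⟩ a ∷ [])
       (≈-rel (r2 X ε α))
  ▹ at (sh⁺ ε a ∷ sh⁺ ⟨1⟩ b ∷ g⁺ Σ ε ∷ g⁺ X (b0 ∷ b0 ∷ α) ∷ [])
       (g⁺ X (b1 ∷ b0 ∷ α) ∷ g⁻ X (b1 ∷ b0 ∷ α) ∷ []) []
       (sh⁻ ⟨1⟩ a ∷ [])
       (≈-cancel pos X (b1 ∷ b0 ∷ α))
  ▹ at (sh⁺ ε a ∷ sh⁺ ⟨1⟩ b ∷ g⁺ Σ ε ∷ [])
       (g⁺ X (b0 ∷ b0 ∷ α) ∷ sh⁻ ⟨1⟩ a ∷ []) (sh⁻ ⟨1⟩ a ∷ g⁺ X (b0 ∷ b0 ∷ α) ∷ [])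
       []
       (≈-sym (intertwine-shifted (left-intertwines-right X (b0 ∷ α) ε) neg a)) )

⋆-appendʳ : ∀ X α a b → a ⋆ (b ++ gen X (b0 ∷ α)) ≈ a ⋆ b ++ gen X (b0 ∷ b1 ∷ α)
⋆-appendʳ X α a b = by-normalising
  (word a ⋆ᴱ (word b ⊕ letter (pos , X , b0 ∷ α))) (word a ⋆ᴱ word b ⊕ letter (pos , X , b0 ∷ b1 ∷ α))
  ( at (sh⁺ ε a ∷ sh⁺ ⟨1⟩ b ∷ [])
       (g⁺ X (b1 ∷ b0 ∷ α) ∷ g⁺ Σ ε ∷ []) (g⁺ Σ ε ∷ g⁺ X (b0 ∷ b1 ∷ α) ∷ [])
       (sh⁻ ⟨1⟩ a ∷ [])
       (≈-rel (r3 X ε α))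
  ▹ at (sh⁺ ε a ∷ sh⁺ ⟨1⟩ b ∷ g⁺ Σ ε ∷ [])
       (g⁺ X (b0 ∷ b1 ∷ α) ∷ sh⁻ ⟨1⟩ a ∷ []) (sh⁻ ⟨1⟩ a ∷ g⁺ X (b0 ∷ b1 ∷ α) ∷ [])
       []
       (≈-sym (intertwine-shifted (left-intertwines-right X (b1 ∷ α) ε) neg a)) )

⊙-appendˡ : ∀ X α a b → (a ++ gen X (b0 ∷ α)) ⊙ b ≈ a ⊙ b ++ gen X (b0 ∷ b0 ∷ α)
⊙-appendˡ X α a b = by-normalising
  ((word a ⊕ letter (pos , X , b0 ∷ α)) ⊙ᴱ word b) (word a ⊙ᴱ word b ⊕ letter (pos , X , b0 ∷ b0 ∷ α))
  ( at (sh⁺ ε a ∷ [])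
       (g⁺ X (b0 ∷ α) ∷ sh⁺ ⟨1⟩ b ∷ []) (sh⁺ ⟨1⟩ b ∷ g⁺ X (b0 ∷ α) ∷ [])
       (g⁺ A ε ∷ [])
       (≈-sym (intertwine-shifted (left-intertwines-right X α ε) pos b))
  ▹ at (sh⁺ ε a ∷ sh⁺ ⟨1⟩ b ∷ [])
       (g⁺ X (b0 ∷ α) ∷ g⁺ A ε ∷ []) (g⁺ A ε ∷ g⁺ X (b0 ∷ b0 ∷ α) ∷ [])
       []
       (≈-rel (r5 X ε α)) )

⊙-appendʳ : ∀ X α a b → a ⊙ (b ++ gen X (b0 ∷ α)) ≈ a ⊙ b ++ gen X (b0 ∷ b1 ∷ α)
⊙-appendʳ X α a b = by-normalising
  (word a ⊙ᴱ (word b ⊕ letter (pos , X , b0 ∷ α))) (word a ⊙ᴱ word b ⊕ letter (pos , X , b0 ∷ b1 ∷ α))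
  (at (sh⁺ ε a ∷ sh⁺ ⟨1⟩ b ∷ [])
      (g⁺ X (b1 ∷ b0 ∷ α) ∷ g⁺ A ε ∷ []) (g⁺ A ε ∷ g⁺ X (b0 ∷ b1 ∷ α) ∷ [])
      [] (≈-rel (r6 X ε α)) )

Cc-LocΣ : ∀ {t t′} → LocΣ t t′ → Cc t′ ≈ Cc t ++ gen Σ ⟨0⟩
Cc-LocΣ (σ* t₁ t₂ t₃) = ⋆-distribˡ-⋆ (Cc t₁) (Cc t₂) (Cc t₃)
Cc-LocΣ (σ∘ t₁ t₂ t₃) = ⋆-distribˡ-⊙ (Cc t₁) (Cc t₂) (Cc t₃)

Cc-LocA : ∀ {t t′} → LocA t t′ → Cc t′ ≈ Cc t ++ gen A ⟨0⟩
Cc-LocA (a* t₁ t₂ t₃) = ⊙-⋆-assoc (Cc t₁) (Cc t₂) (Cc t₃)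

Cc-AtAddr : ∀ {R X} → (∀ {t t′} → R t t′ → Cc t′ ≈ Cc t ++ gen X ⟨0⟩) →
            ∀ {α t t′} → AtAddr R α t t′ → Cc t′ ≈ Cc t ++ gen X (b0 ∷ α)
Cc-AtAddr Cc-R (here r) = Cc-R r
Cc-AtAddr {X = X} Cc-R (l* {α} {t₁} {_} {t₂} r) =
  ≈-trans (⋆-cong (Cc-AtAddr Cc-R r) (≈-refl {Cc t₂})) (⋆-appendˡ X α (Cc t₁) (Cc t₂))
Cc-AtAddr {X = X} Cc-R (r* {α} {t₁} {t₂} r) =
  ≈-trans (⋆-cong (≈-refl {Cc t₁}) (Cc-AtAddr Cc-R r)) (⋆-appendʳ X α (Cc t₁) (Cc t₂))
Cc-AtAddr {X = X} Cc-R (l∘ {α} {t₁} {_} {t₂} r) =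
  ≈-trans (⊙-cong (Cc-AtAddr Cc-R r) (≈-refl {Cc t₂})) (⊙-appendˡ X α (Cc t₁) (Cc t₂))
Cc-AtAddr {X = X} Cc-R (r∘ {α} {t₁} {t₂} r) =
  ≈-trans (⊙-cong (≈-refl {Cc t₁}) (Cc-AtAddr Cc-R r)) (⊙-appendʳ X α (Cc t₁) (Cc t₂))

≈-transpose-lit : ∀ {u v} l → u ≈ v ++ [ l ] → v ≈ u ++ [ lit⁻¹ l ]
≈-transpose-lit {u} {v} l u≈vl = begin
  v                            ≡⟨ ++-identityʳ v ⟨
  v ++ []                      ≈⟨ ++-congˡ v (lit-inverseʳ l []) ⟨
  v ++ l ∷ lit⁻¹ l ∷ []        ≡⟨ ++-assoc v [ l ] [ lit⁻¹ l ] ⟨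
  (v ++ [ l ]) ++ [ lit⁻¹ l ]  ≈⟨ ++-congʳ [ lit⁻¹ l ] u≈vl ⟨
  u ++ [ lit⁻¹ l ]             ∎
  where open SetoidReasoning ≈-setoid

Cc-Step : ∀ ℓ {t t′} → Step ℓ t t′ → Cc t′ ≈ Cc t ++ sh ⟨0⟩ ⟦ [ ℓ ] ⟧
Cc-Step (Σ⁺ α) st = Cc-AtAddr Cc-LocΣ st
Cc-Step (Σ⁻ α) st = ≈-transpose-lit (pos , Σ , b0 ∷ α) (Cc-AtAddr Cc-LocΣ st)
Cc-Step (A⁺ α) st = Cc-AtAddr Cc-LocA st
Cc-Step (A⁻ α) st = ≈-transpose-lit (pos , A , b0 ∷ α) (Cc-AtAddr Cc-LocA st)

⟦⟧-∷ : ∀ ℓ w → ⟦ ℓ ∷ w ⟧ ≡ ⟦ [ ℓ ] ⟧ ++ ⟦ w ⟧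
⟦⟧-∷ (Σ⁺ α) w = refl
⟦⟧-∷ (Σ⁻ α) w = refl
⟦⟧-∷ (A⁺ α) w = refl
⟦⟧-∷ (A⁻ α) w = refl

lemma3p8 : (t t' : T) (w : W) → Eval w t t' → Cc t' ≈ Cc t ++ sh (b0 ∷ []) ⟦ w ⟧
lemma3p8 t .t [] nil = ≡⇒≈ (sym (++-identityʳ (Cc t)))
lemma3p8 t t″ (ℓ ∷ w) (cons {t' = t′} step rest) = begin
  Cc t″                                                ≈⟨ lemma3p8 t′ t″ w rest ⟩
  Cc t′ ++ sh ⟨0⟩ ⟦ w ⟧                                ≈⟨ ++-congʳ (sh ⟨0⟩ ⟦ w ⟧) (Cc-Step ℓ step) ⟩
  (Cc t ++ sh ⟨0⟩ ⟦ [ ℓ ] ⟧) ++ sh ⟨0⟩ ⟦ w ⟧           ≡⟨ ++-assoc (Cc t) _ _ ⟩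
  Cc t ++ sh ⟨0⟩ ⟦ [ ℓ ] ⟧ ++ sh ⟨0⟩ ⟦ w ⟧             ≡⟨ cong (Cc t ++_) (sh-++ ⟨0⟩ ⟦ [ ℓ ] ⟧ ⟦ w ⟧) ⟨
  Cc t ++ sh ⟨0⟩ (⟦ [ ℓ ] ⟧ ++ ⟦ w ⟧)                  ≡⟨ cong (λ u → Cc t ++ sh ⟨0⟩ u) (⟦⟧-∷ ℓ w) ⟨
  Cc t ++ sh ⟨0⟩ ⟦ ℓ ∷ w ⟧                             ∎
  where open SetoidReasoning ≈-setoid
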